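{- If $A$ is a finite abelian group, then $d(\operatorname{Dih}(A))=d(A)+1$, where $d(H)$ denotes the minimum size of a generating set of a group $H$.
   Context: $\operatorname{Dih}(A)$ is the semidirect product $C_2\ltimes A$, where $C_2=\{1,x\}$ and $x$ acts on $A$ by inversion. -}

module Defs where

open import Level using (Level; _⊔_)
open import Data.Nat using (ℕ; _≤_)
open import Data.Bool using (Bool; true; false; _xor_)
open import Data.Bool.Properties using (xor-assoc; xor-identityʳ; xor-same)
open import Data.Product using (_×_; _,_; Σ; ∃)
open import Data.List using (List; length)
open import Data.List.Relation.Unary.Any using (Any)
open import Data.List.Membership.Propositional using (_∈_)
open import Data.Product.Relation.Binary.Pointwise.NonDependent
  using (Pointwise; ×-isEquivalence)
open import Relation.Binary.PropositionalEquality as P using (_≡_)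
open import Algebra.Bundles using (Group; AbelianGroup)
open import Algebra.Bundles.Raw using (RawGroup)
import Algebra.Properties.Group as GP
import Algebra.Properties.AbelianGroup as AGP
import Relation.Binary.Reasoning.Setoid as SR

private
  variable
    c ℓ : Level

IsFiniteGroup : Group c ℓ → Set (c ⊔ ℓ)
IsFiniteGroup G = ∃ λ (xs : List Carrier) → ∀ g → Any (g ≈_) xs
  where open Group G

module _ (G : Group c ℓ) where
  open Group G

  data InSpan (S : List Carrier) : Carrier → Set (c ⊔ ℓ) where
    gen  : ∀ {x} → x ∈ S → InSpan S x
    unit : InSpan S ε
    mul  : ∀ {x y} → InSpan S x → InSpan S y → InSpan S (x ∙ y)
    inv  : ∀ {x} → InSpan S x → InSpan S (x ⁻¹)
    resp : ∀ {x y} → x ≈ y → InSpan S x → InSpan S y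

  Generates : List Carrier → Set (c ⊔ ℓ)
  Generates S = ∀ g → InSpan S g

  IsMinGenSize : ℕ → Set (c ⊔ ℓ)
  IsMinGenSize k =
    (Σ (List Carrier) λ S → length S ≡ k × Generates S) ×
    (∀ S → Generates S → k ≤ length S)

-- Dih(A) = C₂ ⋉ A, C₂ = Bool (true = x) acting on A by inversion.
-- Elements are pairs (a , s) standing for a·x^s; multiplication
--   (a , s) · (b , t) = (a · φ s b , s xor t).

module DihConstruction (A : AbelianGroup c ℓ) where
  open AbelianGroup A
  open GP group using (ε⁻¹≈ε; ⁻¹-involutive; ⁻¹-anti-homo-∙)
  open SR setoid

  φ : Bool → Carrier → Carrier
  φ false a = a
  φ true  a = a ⁻¹

  φ-cong : ∀ s {a b} → a ≈ b → φ s a ≈ φ s b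
  φ-cong false e = e
  φ-cong true  e = ⁻¹-cong e

  φ-hom : ∀ s a b → φ s (a ∙ b) ≈ φ s a ∙ φ s b
  φ-hom false a b = refl
  φ-hom true  a b = trans (⁻¹-anti-homo-∙ a b) (comm _ _)

  φ-ε : ∀ s → φ s ε ≈ ε
  φ-ε false = refl
  φ-ε true  = ε⁻¹≈ε

  φ-φ : ∀ s t a → φ s (φ t a) ≈ φ (s xor t) a
  φ-φ false t a = refl
  φ-φ true false a = refl
  φ-φ true true a = ⁻¹-involutive a

  φ-self : ∀ s a → φ s (φ s a) ≈ a
  φ-self false a = refl
  φ-self true  a = ⁻¹-involutive a

  D : Set c
  D = Carrier × Bool

  _≈D_ : D → D → Set ℓ
  _≈D_ = Pointwise _≈_ _≡_

  _∙D_ : D → D → D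
  (a , s) ∙D (b , t) = (a ∙ φ s b , s xor t)

  εD : D
  εD = (ε , false)

  _⁻¹D : D → D
  (a , s) ⁻¹D = (φ s (a ⁻¹) , s)

  ∙D-cong : ∀ {x x′ y y′} → x ≈D x′ → y ≈D y′ → (x ∙D y) ≈D (x′ ∙D y′)
  ∙D-cong {_ , s} (e₁ , P.refl) (e₂ , P.refl) = ∙-cong e₁ (φ-cong s e₂) , P.refl

  ⁻¹D-cong : ∀ {x y} → x ≈D y → (x ⁻¹D) ≈D (y ⁻¹D)
  ⁻¹D-cong {_ , s} (e , P.refl) = φ-cong s (⁻¹-cong e) , P.refl

  assocD : ∀ x y z → ((x ∙D y) ∙D z) ≈D (x ∙D (y ∙D z))
  assocD (a , s) (b , t) (c′ , u) =
    (begin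
      (a ∙ φ s b) ∙ φ (s xor t) c′   ≈⟨ assoc _ _ _ ⟩
      a ∙ (φ s b ∙ φ (s xor t) c′)   ≈⟨ ∙-congˡ (∙-congˡ (sym (φ-φ s t c′))) ⟩
      a ∙ (φ s b ∙ φ s (φ t c′))     ≈⟨ ∙-congˡ (sym (φ-hom s b (φ t c′))) ⟩
      a ∙ φ s (b ∙ φ t c′)           ∎)
    , xor-assoc s t u

  identityˡD : ∀ x → (εD ∙D x) ≈D x
  identityˡD (a , s) = identityˡ a , P.refl

  identityʳD : ∀ x → (x ∙D εD) ≈D x
  identityʳD (a , s) = trans (∙-congˡ (φ-ε s)) (identityʳ a) , xor-identityʳ s

  inverseˡD : ∀ x → ((x ⁻¹D) ∙D x) ≈D εD
  inverseˡD (a , s) =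
    (begin
      φ s (a ⁻¹) ∙ φ s a   ≈⟨ sym (φ-hom s (a ⁻¹) a) ⟩
      φ s (a ⁻¹ ∙ a)       ≈⟨ φ-cong s (inverseˡ a) ⟩
      φ s ε                ≈⟨ φ-ε s ⟩
      ε                    ∎)
    , xor-same s

  inverseʳD : ∀ x → (x ∙D (x ⁻¹D)) ≈D εD
  inverseʳD (a , s) =
    trans (∙-congˡ (φ-self s (a ⁻¹))) (inverseʳ a) , xor-same s

Dih : AbelianGroup c ℓ → Group c ℓ
Dih A = record
  { Carrier = D
  ; _≈_ = _≈D_
  ; _∙_ = _∙D_
  ; ε = εD
  ; _⁻¹ = _⁻¹D
  ; isGroup = record
    { isMonoid = record
      { isSemigroup = record
        { isMagma = record
          { isEquivalence = ×-isEquivalence isEquivalence P.isEquivalence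
          ; ∙-cong = ∙D-cong
          }
        ; assoc = assocD
        }
      ; identity = identityˡD , identityʳD
      }
    ; inverse = inverseˡD , inverseʳD
    ; ⁻¹-cong = ⁻¹D-cong
    }
  }
  where open DihConstruction A
        open AbelianGroup A using (isEquivalence)

-- Dih(A) is generated by A together with one reflection, which gives d(Dih A) ≤ d(A) + 1.
-- Conversely, fix a reflection ρ = (b , true) and write every element as (a , false)·ρ^s; the
-- rotation coordinate a of a product depends only on the coordinates of the factors, so the
-- coordinates of a generating set S of Dih(A) generate A. Some generator of S must be a
-- reflection, and taking ρ to be that generator its coordinate is b · b⁻¹ = ε, which can be
-- dropped: A is generated by |S| − 1 elements.
module Submission where

open import Defs
open import Level using (Level)
open import Function using (_∘_)
open import Data.Nat using (ℕ; suc; _≤_; _+_; s≤s)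
open import Data.Nat.Properties using (+-suc; +-comm)
open import Data.Bool using (true; false)
open import Data.Product using (_,_; ∃)
open import Data.Sum using (_⊎_; inj₁; inj₂)
open import Data.List using (List; []; _∷_; _++_; [_]; map; length)
open import Data.List.Properties using (length-++; length-map; map-++)
open import Data.List.Relation.Unary.All as All using (All; []; _∷_)
open import Data.List.Relation.Unary.Any using (here; there)
open import Data.List.Membership.Propositional using (_∈_)
open import Data.List.Membership.Propositional.Properties
  using (∈-++⁻; ∈-++⁺ˡ; ∈-++⁺ʳ; ∈-map⁺; ∈-∃++)
open import Relation.Binary.PropositionalEquality as P using (_≡_; refl)
open import Algebra.Bundles using (Group; AbelianGroup)
open import Algebra.Morphism.Structures using (module GroupMorphisms)
import Algebra.Properties.Group as GroupProperties
import Relation.Binary.Reasoning.Setoid as SetoidReasoning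

module _ {c₁ ℓ₁ c₂ ℓ₂ : Level} {G : Group c₁ ℓ₁} {H : Group c₂ ℓ₂} where
  open Group using (rawGroup)
  open GroupMorphisms (rawGroup G) (rawGroup H) using (IsGroupHomomorphism)

  InSpan-map : ∀ {f} → IsGroupHomomorphism f →
               ∀ {S x} → InSpan G S x → InSpan H (map f S) (f x)
  InSpan-map {f} hom = go
    where
    open IsGroupHomomorphism hom
    open Group H using (sym)
    go : ∀ {S x} → InSpan G S x → InSpan H (map f S) (f x)
    go (gen x∈S)  = gen (∈-map⁺ f x∈S)
    go unit       = resp (sym ε-homo) unit
    go (mul p q)  = resp (sym (homo _ _)) (mul (go p) (go q))
    go (inv p)    = resp (sym (⁻¹-homo _)) (inv (go p))
    go (resp e p) = resp (⟦⟧-cong e) (go p)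

module _ {c ℓ : Level} {G : Group c ℓ} where
  open Group G

  InSpan-trans : ∀ {S T} → (∀ {y} → y ∈ S → InSpan G T y) →
                 ∀ {x} → InSpan G S x → InSpan G T x
  InSpan-trans S⊆T (gen y∈S)  = S⊆T y∈S
  InSpan-trans S⊆T unit       = unit
  InSpan-trans S⊆T (mul p q)  = mul (InSpan-trans S⊆T p) (InSpan-trans S⊆T q)
  InSpan-trans S⊆T (inv p)    = inv (InSpan-trans S⊆T p)
  InSpan-trans S⊆T (resp e p) = resp e (InSpan-trans S⊆T p)

  Generates-remove-ε : ∀ xs {y} ys → y ≈ ε →
                       Generates G (xs ++ y ∷ ys) → Generates G (xs ++ ys)
  Generates-remove-ε xs ys y≈ε gens g = InSpan-trans shrink (gens g)
    where
    shrink : ∀ {z} → z ∈ xs ++ _ ∷ ys → InSpan G (xs ++ ys) z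
    shrink z∈ with ∈-++⁻ xs z∈
    ... | inj₁ z∈xs         = gen (∈-++⁺ˡ z∈xs)
    ... | inj₂ (here refl)  = resp (sym y≈ε) unit
    ... | inj₂ (there z∈ys) = gen (∈-++⁺ʳ xs z∈ys)

module _ {c ℓ : Level} (A : AbelianGroup c ℓ) where
  open AbelianGroup A renaming (refl to ≈-refl)
  open GroupProperties group using (⁻¹-involutive; ⁻¹-anti-homo-∙)
  open DihConstruction A using (D)
  open GroupMorphisms (Group.rawGroup group) (Group.rawGroup (Dih A))
    using (IsGroupHomomorphism)

  rotation : Carrier → D
  rotation a = (a , false)

  reflection : Carrier → D
  reflection b = (b , true)

  rotation-isGroupHomomorphism : IsGroupHomomorphism rotation
  rotation-isGroupHomomorphism = record
    { isMonoidHomomorphism = record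
      { isMagmaHomomorphism = record
        { isRelHomomorphism = record { cong = _, refl }
        ; homo              = λ _ _ → ≈-refl , refl
        }
      ; ε-homo = ≈-refl , refl
      }
    ; ⁻¹-homo = λ _ → ≈-refl , refl
    }

  Dih-generated-by-rotations-and-reflection :
    ∀ {S} → Generates group S → Generates (Dih A) (map rotation S ++ [ reflection ε ])
  Dih-generated-by-rotations-and-reflection {S} gens (a , s) =
    resp (identityʳ a , refl) (mul rotation-a (reflection-power s))
    where
    rotation-a : InSpan (Dih A) (map rotation S ++ [ reflection ε ]) (rotation a)
    rotation-a = InSpan-trans (gen ∘ ∈-++⁺ˡ) (InSpan-map rotation-isGroupHomomorphism (gens a))
    reflection-power : ∀ s → InSpan (Dih A) (map rotation S ++ [ reflection ε ]) (ε , s)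
    reflection-power false = unit
    reflection-power true  = gen (∈-++⁺ʳ (map rotation S) (here refl))

  length-rotations-and-reflection :
    ∀ S → length (map rotation S ++ [ reflection ε ]) ≡ suc (length S)
  length-rotations-and-reflection S =
    P.trans (length-++ (map rotation S))
            (P.trans (P.cong (_+ 1) (length-map rotation S)) (+-comm (length S) 1))

  IsRotation : D → Set
  IsRotation (_ , s) = s ≡ false

  InSpan-rotations : ∀ {S x} → All IsRotation S → InSpan (Dih A) S x → IsRotation x
  InSpan-rotations rots (gen x∈S) = All.lookup rots x∈S
  InSpan-rotations rots unit      = refl
  InSpan-rotations rots (mul p q) with InSpan-rotations rots p | InSpan-rotations rots q
  ... | refl | refl = refl
  InSpan-rotations rots (inv p)   = InSpan-rotations rots p
  InSpan-rotations rots (resp (_ , refl) p) = InSpan-rotations rots p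

  reflection-∈-or-rotations : ∀ S → (∃ λ b → reflection b ∈ S) ⊎ All IsRotation S
  reflection-∈-or-rotations []             = inj₂ []
  reflection-∈-or-rotations ((b , true) ∷ S) = inj₁ (b , here refl)
  reflection-∈-or-rotations ((a , false) ∷ S) with reflection-∈-or-rotations S
  ... | inj₁ (b , b∈S) = inj₁ (b , there b∈S)
  ... | inj₂ rots      = inj₂ (refl ∷ rots)

  generators-contain-reflection : ∀ {S} → Generates (Dih A) S → ∃ λ b → reflection b ∈ S
  generators-contain-reflection {S} gens with reflection-∈-or-rotations S
  ... | inj₁ ρ∈S = ρ∈S
  ... | inj₂ rots   with InSpan-rotations rots (gens (reflection ε))
  ...   | ()

  module _ (b : Carrier) where
    -- Every element of Dih(A) is rotation a · reflection b ^ s for a unique a; this is that a.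
    rotationPart : D → Carrier
    rotationPart (a , false) = a
    rotationPart (a , true)  = a ∙ b ⁻¹

    private
      open SetoidReasoning setoid

      ∙-swapʳ : ∀ x y z → (x ∙ y) ∙ z ≈ (x ∙ z) ∙ y
      ∙-swapʳ x y z = begin
        (x ∙ y) ∙ z  ≈⟨ assoc x y z ⟩
        x ∙ (y ∙ z)  ≈⟨ ∙-congˡ (comm y z) ⟩
        x ∙ (z ∙ y)  ≈⟨ assoc x z y ⟨
        (x ∙ z) ∙ y  ∎

      reflection-quotient : ∀ a a′ → (a ∙ b ⁻¹) ∙ (a′ ∙ b ⁻¹) ⁻¹ ≈ a ∙ a′ ⁻¹
      reflection-quotient a a′ = begin
        (a ∙ b ⁻¹) ∙ (a′ ∙ b ⁻¹) ⁻¹     ≈⟨ ∙-congˡ (⁻¹-anti-homo-∙ a′ (b ⁻¹)) ⟩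
        (a ∙ b ⁻¹) ∙ ((b ⁻¹) ⁻¹ ∙ a′ ⁻¹) ≈⟨ ∙-congˡ (∙-congʳ (⁻¹-involutive b)) ⟩
        (a ∙ b ⁻¹) ∙ (b ∙ a′ ⁻¹)        ≈⟨ assoc a (b ⁻¹) (b ∙ a′ ⁻¹) ⟩
        a ∙ (b ⁻¹ ∙ (b ∙ a′ ⁻¹))        ≈⟨ ∙-congˡ (assoc (b ⁻¹) b (a′ ⁻¹)) ⟨
        a ∙ ((b ⁻¹ ∙ b) ∙ a′ ⁻¹)        ≈⟨ ∙-congˡ (∙-congʳ (inverseˡ b)) ⟩
        a ∙ (ε ∙ a′ ⁻¹)                 ≈⟨ ∙-congˡ (identityˡ (a′ ⁻¹)) ⟩
        a ∙ a′ ⁻¹                       ∎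

    InSpan-rotationPart : ∀ {S x} → InSpan (Dih A) S x → InSpan group (map rotationPart S) (rotationPart x)
    InSpan-rotationPart (gen x∈S) = gen (∈-map⁺ rotationPart x∈S)
    InSpan-rotationPart unit      = unit
    InSpan-rotationPart (mul {a , false} {a′ , false} p q) =
      mul (InSpan-rotationPart p) (InSpan-rotationPart q)
    InSpan-rotationPart (mul {a , false} {a′ , true} p q) =
      resp (sym (assoc a a′ (b ⁻¹))) (mul (InSpan-rotationPart p) (InSpan-rotationPart q))
    InSpan-rotationPart (mul {a , true} {a′ , false} p q) =
      resp (∙-swapʳ a (b ⁻¹) (a′ ⁻¹)) (mul (InSpan-rotationPart p) (inv (InSpan-rotationPart q)))
    InSpan-rotationPart (mul {a , true} {a′ , true} p q) =
      resp (reflection-quotient a a′) (mul (InSpan-rotationPart p) (inv (InSpan-rotationPart q)))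
    InSpan-rotationPart (inv {a , false} p) = inv (InSpan-rotationPart p)
    InSpan-rotationPart (inv {a , true} p)  =
      resp (∙-congʳ (sym (⁻¹-involutive a))) (InSpan-rotationPart p)
    InSpan-rotationPart (resp {a , false} (e , refl) p) = resp e (InSpan-rotationPart p)
    InSpan-rotationPart (resp {a , true} (e , refl) p)  = resp (∙-congʳ e) (InSpan-rotationPart p)

  generating-set-without-reflection :
    ∀ xs b ys → Generates (Dih A) (xs ++ reflection b ∷ ys) →
    Generates group (map (rotationPart b) xs ++ map (rotationPart b) ys)
  generating-set-without-reflection xs b ys gens =
    Generates-remove-ε (map (rotationPart b) xs) (map (rotationPart b) ys) (inverseʳ b) gens′
    where
    gens′ : Generates group (map (rotationPart b) xs ++ rotationPart b (reflection b) ∷ map (rotationPart b) ys)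
    gens′ a = P.subst (λ T → InSpan group T a) (map-++ (rotationPart b) xs (reflection b ∷ ys))
                (InSpan-rotationPart b (gens (rotation a)))

  generating-set-size-Dih : ∀ k → (∀ S → Generates group S → k ≤ length S) →
                            ∀ S → Generates (Dih A) S → suc k ≤ length S
  generating-set-size-Dih k minimal S gens
    with b , b∈S ← generators-contain-reflection gens
    with xs , ys , refl ← ∈-∃++ b∈S =
    P.subst (suc k ≤_) (P.sym length-S) (s≤s k≤)
    where
    k≤ : k ≤ length xs + length ys
    k≤ = P.subst (k ≤_) lengths (minimal _ (generating-set-without-reflection xs b ys gens))
      where
      lengths : length (map (rotationPart b) xs ++ map (rotationPart b) ys) ≡ length xs + length ys
      lengths = P.trans (length-++ (map (rotationPart b) xs))
                        (P.cong₂ _+_ (length-map (rotationPart b) xs) (length-map (rotationPart b) ys))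
    length-S : length (xs ++ reflection b ∷ ys) ≡ suc (length xs + length ys)
    length-S = P.trans (length-++ xs) (+-suc (length xs) (length ys))

proposition4p3 : ∀ {c ℓ : Level} (A : AbelianGroup c ℓ) →
    IsFiniteGroup (AbelianGroup.group A) →
    ∀ (k : ℕ) → IsMinGenSize (AbelianGroup.group A) k →
    IsMinGenSize (Dih A) (suc k)
proposition4p3 A _ k ((S , |S|≡k , gens) , minimal) =
  ( ( map (rotation A) S ++ [ reflection A ε ]
    , P.trans (length-rotations-and-reflection A S) (P.cong suc |S|≡k)
    , Dih-generated-by-rotations-and-reflection A gens )
  , generating-set-size-Dih A k minimal )
  where open AbelianGroup A using (ε)
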